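{- For the complete bipartite graph $K_{a,b}$ with $1\le a\le b$ and $a+b=n$, \begin{align*} \mathrm{pn}(K_{a,b})={}&\binom a2\sum_{k=1}^{a}\binom bk k!\cdot\binom{a-2}{k-1}(k-1)!\\ &+\binom b2\sum_{k=1}^{a+1}\binom ak k!\cdot\binom{b-2}{k-1}(k-1)!\\ &+a\cdot b\sum_{k=1}^{a}\binom{a-1}{k-1}(k-1)!\cdot\binom{b-1}{k-1}(k-1)!+n . \end{align*}
   Context: For a graph $G$, the subpath number $\mathrm{pn}(G)$ is the number of paths (as subgraphs, i.e. unordered) in $G$, including the trivial paths of length $0$ (single vertices). Binomial coefficients $\binom{m}{j}$ are $0$ when $j>m$ or $j<0$ (and $\binom{m}{2}=0$ for $m<2$). -}

module Defs where

open import Data.Bool using (Bool; true; false; _∧_; not; if_then_else_)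
open import Data.Nat using (ℕ; zero; suc; _+_; _*_; _∸_; _<ᵇ_; _!)
open import Data.Nat.ListAction using (sum)
open import Data.Nat.Combinatorics using (_C_)
open import Data.Fin using (Fin; toℕ)
open import Data.Fin.Properties using (_≟_)
open import Data.List using (List; []; _∷_; map; concatMap; length; filterᵇ; allFin; upTo)
open import Relation.Nullary.Decidable using (⌊_⌋)

-- A (simple, undirected) graph on vertex set Fin n, given by a Boolean
-- adjacency relation (intended to be symmetric and irreflexive).
Graph : ℕ → Set
Graph n = Fin n → Fin n → Bool

side : {n : ℕ} → ℕ → Fin n → Bool
side a v = toℕ v <ᵇ a

K : (a b : ℕ) → Graph (a + b)
K a b u v = not (eqB (side a u) (side a v))
  where
  eqB : Bool → Bool → Bool
  eqB true true = true
  eqB false false = true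
  eqB _ _ = false

module _ {n : ℕ} where

  elemB : Fin n → List (Fin n) → Bool
  elemB x [] = false
  elemB x (y ∷ ys) = if ⌊ x ≟ y ⌋ then true else elemB x ys

  distinctB : List (Fin n) → Bool
  distinctB [] = true
  distinctB (x ∷ xs) = not (elemB x xs) ∧ distinctB xs

  adjChain : Graph n → List (Fin n) → Bool
  adjChain G [] = true
  adjChain G (x ∷ []) = true
  adjChain G (x ∷ y ∷ ys) = G x y ∧ adjChain G (y ∷ ys)

  lastOr : Fin n → List (Fin n) → Fin n
  lastOr d [] = d
  lastOr d (x ∷ xs) = lastOr x xs

  isPathSeq : Graph n → List (Fin n) → Bool
  isPathSeq G [] = false
  isPathSeq G (x ∷ xs) = distinctB (x ∷ xs) ∧ adjChain G (x ∷ xs)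

  -- A path as a subgraph (unordered) corresponds to exactly two vertex
  -- sequences (a sequence and its reverse) when it has length ≥ 1, and to
  -- one sequence when it is a single vertex.
  canonical : List (Fin n) → Bool
  canonical [] = false
  canonical (x ∷ []) = true
  canonical (x ∷ xs) = toℕ x <ᵇ toℕ (lastOr x xs)

  allLists : ℕ → List (List (Fin n))
  allLists zero = [] ∷ []
  allLists (suc k) = concatMap (λ v → map (v ∷_) (allLists k)) (allFin n)

  -- all vertex lists of length 0 … n (a path has at most n vertices)
  allShortLists : List (List (Fin n))
  allShortLists = concatMap allLists (upTo (suc n))

-- subpath number: number of paths (as subgraphs, including single vertices)
pn : {n : ℕ} → Graph n → ℕ
pn G = length (filterᵇ (λ xs → isPathSeq G xs ∧ canonical xs) allShortLists)

sumFrom1 : ℕ → (ℕ → ℕ) → ℕ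
sumFrom1 m f = sum (map (λ i → f (suc i)) (upTo m))

pnFormula : ℕ → ℕ → ℕ
pnFormula a b =
    (a C 2) * sumFrom1 a (λ k → (b C k) * k ! * ((a ∸ 2) C (k ∸ 1)) * (k ∸ 1) !)
  + (b C 2) * sumFrom1 (suc a) (λ k → (a C k) * k ! * ((b ∸ 2) C (k ∸ 1)) * (k ∸ 1) !)
  + a * b * sumFrom1 a (λ k → ((a ∸ 1) C (k ∸ 1)) * (k ∸ 1) ! * ((b ∸ 1) C (k ∸ 1)) * (k ∸ 1) !)
  + (a + b)

module Submission where

open import Defs
open import Data.Nat using (ℕ; _≤_)
open import Relation.Binary.PropositionalEquality using (_≡_)

open import Data.Nat.Base using (zero; suc; _+_; _*_; _∸_; _<ᵇ_; _<_; _!; z≤n; s≤s; ⌊_/2⌋)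
open import Data.Nat.Properties hiding (_≟_)
open import Data.Nat.Combinatorics using (_C_; nCk≡nPk/k!)
open import Data.Nat.Combinatorics.Base using (_P′_)
import Data.Nat.Combinatorics.Base as Combinatorics
open import Data.Nat.Combinatorics.Specification using (k!∣nP′k; k>n⇒nCk≡0)
open import Data.Nat.DivMod using (_/_; m/n*n≡m)
open import Data.Nat.ListAction using () renaming (sum to sumList)
open import Data.Nat.Tactic.RingSolver using (solve-∀)
open import Data.Bool.Base using (Bool; true; false; not; _∧_; _∨_; _xor_; if_then_else_)
open import Data.Bool.Properties
  using ( ∧-commutativeMonoid; ∨-commutativeMonoid; ∧-identityʳ; ∧-conicalˡ; ∧-conicalʳ; ∧-assoc; xor-comm
        ; not-involutive; T-≡)
open import Data.Bool.ListAction using (all)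
open import Data.Fin.Base using (Fin; toℕ)
open import Data.Fin.Properties using (_≟_; toℕ-injective)
open import Data.List.Base
  using (List; []; _∷_; _++_; _∷ʳ_; _ʳ++_; reverse; map; concatMap; length; filterᵇ; allFin; upTo; applyUpTo; tabulate)
open import Data.List.Properties using (unfold-reverse; reverse-++; ++-identityʳ)
open import Algebra.Properties.Semiring.Sum +-*-semiring
  using (sum-syntax; sum-cong-≗; ∑-comm; ∑-distrib-+; *-distribˡ-sum; *-distribʳ-sum)
import Algebra.Solver.CommutativeMonoid ∧-commutativeMonoid as ∧-Solver
import Algebra.Solver.CommutativeMonoid ∨-commutativeMonoid as ∨-Solver
open import Function.Base using (_∘_)
open import Function.Bundles using (Equivalence)
open import Relation.Nullary.Decidable using (does; yes; no; dec-true; dec-false)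
open import Relation.Nullary.Negation using (contradiction)
open import Relation.Binary.PropositionalEquality using (_≢_; refl; sym; trans; subst; cong; cong₂; module ≡-Reasoning)

-- In K_{a,b} a vertex sequence is a path exactly when its vertices are distinct and
-- alternate between the two sides, so the sequences with m vertices starting on a
-- side of size p (the other side having size q) number p·q·(p−1)·(q−1)⋯, a product
-- of two falling factorials xₖ = x(x−1)⋯(x−k+1).  A path with at least one edge has
-- exactly two vertex sequences, reverses of each other, and exactly one of them is
-- canonical; so the paths with l ≥ 1 edges are half as many as their vertex sequences.
-- For l = 2k+1 the ends lie on different sides, giving ab·(a−1)ₖ(b−1)ₖ paths; for
-- l = 2k+2 they lie on the same side, giving C(a,2)·b₍ₖ₊₁₎(a−2)ₖ + C(b,2)·a₍ₖ₊₁₎(b−2)ₖ.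
-- Summing over k and adding the a + b single vertices gives the formula.

⟦_⟧ : Bool → ℕ
⟦ true ⟧ = 1
⟦ false ⟧ = 0

⟦∧⟧ : ∀ x y → ⟦ x ∧ y ⟧ ≡ ⟦ x ⟧ * ⟦ y ⟧
⟦∧⟧ true y = sym (+-identityʳ ⟦ y ⟧)
⟦∧⟧ false y = refl

⟦⟧*-cong : ∀ b {x y} → (b ≡ true → x ≡ y) → ⟦ b ⟧ * x ≡ ⟦ b ⟧ * y
⟦⟧*-cong true x≡y = cong (1 *_) (x≡y refl)
⟦⟧*-cong false x≡y = refl

⟦<ᵇ⟧-connex : ∀ {i j} → i ≢ j → ⟦ i <ᵇ j ⟧ + ⟦ j <ᵇ i ⟧ ≡ 1
⟦<ᵇ⟧-connex {zero} {zero} i≢j = contradiction refl i≢j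
⟦<ᵇ⟧-connex {zero} {suc j} _ = refl
⟦<ᵇ⟧-connex {suc i} {zero} _ = refl
⟦<ᵇ⟧-connex {suc i} {suc j} i≢j = ⟦<ᵇ⟧-connex (i≢j ∘ cong suc)

∨-swap : ∀ p q r → p ∨ (q ∨ r) ≡ q ∨ (p ∨ r)
∨-swap = solve 3 (λ p q r → p ⊕ (q ⊕ r) ⊜ q ⊕ (p ⊕ r)) refl
  where open ∨-Solver

not-∨-swap : ∀ d e f g → not (d ∨ e) ∧ (not f ∧ g) ≡ not (d ∨ f) ∧ (not e ∧ g)
not-∨-swap true e f g = refl
not-∨-swap false e f g = solve 3 (λ x y z → x ⊕ (y ⊕ z) ⊜ y ⊕ (x ⊕ z)) refl (not e) (not f) g
  where open ∧-Solver

∑-0 : ∀ n → ∑[ i < n ] 0 ≡ 0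
∑-0 zero = refl
∑-0 (suc n) = ∑-0 n

∑-1 : ∀ n → ∑[ i < n ] 1 ≡ n
∑-1 zero = refl
∑-1 (suc n) = cong suc (∑-1 n)

∑-δ : ∀ {n} (y : Fin n) (h : Fin n → ℕ) → ∑[ v < n ] (⟦ does (v ≟ y) ⟧ * h v) ≡ h y
∑-δ {suc n} Fin.zero h = trans (cong₂ _+_ (+-identityʳ (h Fin.zero)) (∑-0 n)) (+-identityʳ (h Fin.zero))
∑-δ {suc n} (Fin.suc y) h = ∑-δ y (h ∘ Fin.suc)

∑-linear₃ : ∀ {n} x y z (f g h : Fin n → ℕ) →
            ∑[ k < n ] (x * f k + (y * g k + z * h k)) ≡ x * ∑[ k < n ] f k + (y * ∑[ k < n ] g k + z * ∑[ k < n ] h k)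
∑-linear₃ {n} x y z f g h = begin
  ∑[ k < n ] (x * f k + (y * g k + z * h k))
    ≡⟨ ∑-distrib-+ (λ k → x * f k) (λ k → y * g k + z * h k) ⟩
  ∑[ k < n ] (x * f k) + ∑[ k < n ] (y * g k + z * h k)
    ≡⟨ cong (∑[ k < n ] (x * f k) +_) (∑-distrib-+ (λ k → y * g k) (λ k → z * h k)) ⟩
  ∑[ k < n ] (x * f k) + (∑[ k < n ] (y * g k) + ∑[ k < n ] (z * h k))
    ≡⟨ cong₂ _+_ (*-distribˡ-sum x f) (cong₂ _+_ (*-distribˡ-sum y g) (*-distribˡ-sum z h)) ⟨
  x * ∑[ k < n ] f k + (y * ∑[ k < n ] g k + z * ∑[ k < n ] h k) ∎
  where open ≡-Reasoning

∑-truncate : ∀ {m n} (f : ℕ → ℕ) → m ≤ n → (∀ i → m ≤ i → f i ≡ 0) →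
             ∑[ i < n ] f (toℕ i) ≡ ∑[ i < m ] f (toℕ i)
∑-truncate {zero} {zero} f _ _ = refl
∑-truncate {zero} {suc n} f _ f≡0 =
  cong₂ _+_ (f≡0 0 z≤n) (∑-truncate {zero} {n} (f ∘ suc) z≤n (λ i _ → f≡0 (suc i) z≤n))
∑-truncate {suc m} {suc n} f (s≤s m≤n) f≡0 =
  cong (f 0 +_) (∑-truncate (f ∘ suc) m≤n (λ i m≤i → f≡0 (suc i) (s≤s m≤i)))

∑-by-parity : ∀ M (g : ℕ → ℕ) →
              ∑[ i < suc (M * 2) ] g (toℕ i) ≡ g 0 + ∑[ k < M ] (g (suc (toℕ k * 2)) + g (suc (suc (toℕ k * 2))))
∑-by-parity zero g = refl
∑-by-parity (suc M) g =
  cong (g 0 +_) (trans (cong (g 1 +_) (∑-by-parity M (g ∘ suc ∘ suc))) (sym (+-assoc (g 1) (g 2) _)))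

sumList-applyUpTo : ∀ (h g : ℕ → ℕ) m → sumList (map h (applyUpTo g m)) ≡ ∑[ i < m ] h (g (toℕ i))
sumList-applyUpTo h g zero = refl
sumList-applyUpTo h g (suc m) = cong (h (g 0) +_) (sumList-applyUpTo h (g ∘ suc) m)

sumList-tabulate : ∀ {A : Set} {m} (h : A → ℕ) (g : Fin m → A) → sumList (map h (tabulate g)) ≡ ∑[ i < m ] h (g i)
sumList-tabulate {m = zero} h g = refl
sumList-tabulate {m = suc m} h g = cong (h (g Fin.zero) +_) (sumList-tabulate h (g ∘ Fin.suc))

module _ {A : Set} (p : A → Bool) where
  open ≡-Reasoning

  length-filterᵇ-∷ : ∀ x xs → length (filterᵇ p (x ∷ xs)) ≡ ⟦ p x ⟧ + length (filterᵇ p xs)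
  length-filterᵇ-∷ x xs with p x
  ... | true = refl
  ... | false = refl

  length-filterᵇ-++ : ∀ xs ys → length (filterᵇ p (xs ++ ys)) ≡ length (filterᵇ p xs) + length (filterᵇ p ys)
  length-filterᵇ-++ [] ys = refl
  length-filterᵇ-++ (x ∷ xs) ys = begin
    length (filterᵇ p (x ∷ xs ++ ys))                           ≡⟨ length-filterᵇ-∷ x (xs ++ ys) ⟩
    ⟦ p x ⟧ + length (filterᵇ p (xs ++ ys))                     ≡⟨ cong (⟦ p x ⟧ +_) (length-filterᵇ-++ xs ys) ⟩
    ⟦ p x ⟧ + (length (filterᵇ p xs) + length (filterᵇ p ys))   ≡⟨ +-assoc ⟦ p x ⟧ _ _ ⟨
    ⟦ p x ⟧ + length (filterᵇ p xs) + length (filterᵇ p ys)     ≡⟨ cong (_+ length (filterᵇ p ys)) (length-filterᵇ-∷ x xs) ⟨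
    length (filterᵇ p (x ∷ xs)) + length (filterᵇ p ys)         ∎

  length-filterᵇ-concatMap : ∀ {B : Set} (f : B → List A) xs →
    length (filterᵇ p (concatMap f xs)) ≡ sumList (map (λ x → length (filterᵇ p (f x))) xs)
  length-filterᵇ-concatMap f [] = refl
  length-filterᵇ-concatMap f (x ∷ xs) =
    trans (length-filterᵇ-++ (f x) (concatMap f xs)) (cong (_ +_) (length-filterᵇ-concatMap f xs))

length-filterᵇ-map : ∀ {A B : Set} (p : B → Bool) (g : A → B) xs →
  length (filterᵇ p (map g xs)) ≡ length (filterᵇ (p ∘ g) xs)
length-filterᵇ-map p g [] = refl
length-filterᵇ-map p g (x ∷ xs) =
  trans (length-filterᵇ-∷ p (g x) (map g xs))
        (trans (cong (_ +_) (length-filterᵇ-map p g xs)) (sym (length-filterᵇ-∷ (p ∘ g) x xs)))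

+-self-injective : ∀ {x y} → x + x ≡ y + y → x ≡ y
+-self-injective {x} {y} eq = trans (n≡⌊n+n/2⌋ x) (trans (cong ⌊_/2⌋ eq) (sym (n≡⌊n+n/2⌋ y)))

m∸[1+n]<m : ∀ {m} n → 1 ≤ m → m ∸ suc n < m
m∸[1+n]<m {suc m} n _ = s≤s (m∸n≤m m n)

fall : ℕ → ℕ → ℕ
fall n zero = 1
fall n (suc k) = n * fall (n ∸ 1) k

fall-vanishes : ∀ {n k} → n < k → fall n k ≡ 0
fall-vanishes {zero} {suc k} _ = refl
fall-vanishes {suc n} {suc k} (s≤s n<k) = trans (cong (suc n *_) (fall-vanishes n<k)) (*-zeroʳ (suc n))

fall-suc : ∀ n k → fall n (suc k) ≡ fall n k * (n ∸ k)
fall-suc n zero = trans (*-identityʳ n) (sym (+-identityʳ n))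
fall-suc n (suc k) = begin
  n * fall (n ∸ 1) (suc k)            ≡⟨ cong (n *_) (fall-suc (n ∸ 1) k) ⟩
  n * (fall (n ∸ 1) k * (n ∸ 1 ∸ k))  ≡⟨ *-assoc n _ _ ⟨
  n * fall (n ∸ 1) k * (n ∸ 1 ∸ k)    ≡⟨ cong (n * fall (n ∸ 1) k *_) (∸-+-assoc n 1 k) ⟩
  n * fall (n ∸ 1) k * (n ∸ suc k)    ∎
  where open ≡-Reasoning

fall≡P′ : ∀ n k → fall n k ≡ n P′ k
fall≡P′ n zero = refl
fall≡P′ n (suc k) = trans (fall-suc n k) (trans (*-comm (fall n k) (n ∸ k)) (cong ((n ∸ k) *_) (fall≡P′ n k)))

C*!≡fall : ∀ n k → (n C k) * k ! ≡ fall n k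
C*!≡fall n k with k ≤? n
... | yes k≤n = begin
  (n C k) * k !                                     ≡⟨ cong (_* k !) (nCk≡nPk/k! k≤n) ⟩
  ((n Combinatorics.P k) / k !) {{k !≢0}} * k !
    ≡⟨ cong (λ b → ((if b then n P′ k else 0) / k !) {{k !≢0}} * k !) (Equivalence.to T-≡ (≤⇒≤ᵇ k≤n)) ⟩
  ((n P′ k) / k !) {{k !≢0}} * k !                 ≡⟨ m/n*n≡m {{k !≢0}} (k!∣nP′k k≤n) ⟩
  n P′ k                                            ≡⟨ fall≡P′ n k ⟨
  fall n k                                          ∎
  where open ≡-Reasoning
... | no k≰n = trans (cong (_* k !) (k>n⇒nCk≡0 (≰⇒> k≰n))) (sym (fall-vanishes (≰⇒> k≰n)))

C*!-product : ∀ m j m′ j′ → (m C j) * j ! * (m′ C j′) * j′ ! ≡ fall m j * fall m′ j′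
C*!-product m j m′ j′ = trans (regroup (m C j) (j !) (m′ C j′) (j′ !)) (cong₂ _*_ (C*!≡fall m j) (C*!≡fall m′ j′))
  where
  regroup : ∀ w x y z → w * x * y * z ≡ (w * x) * (y * z)
  regroup = solve-∀

fall-suc-suc : ∀ n k → fall n (suc (suc k)) ≡ (n C 2) * 2 * fall (n ∸ 2) k
fall-suc-suc n k = begin
  n * ((n ∸ 1) * fall (n ∸ 1 ∸ 1) k)   ≡⟨ cong (λ m → n * ((n ∸ 1) * fall m k)) (∸-+-assoc n 1 1) ⟩
  n * ((n ∸ 1) * fall (n ∸ 2) k)       ≡⟨ regroup n (n ∸ 1) (fall (n ∸ 2) k) ⟩
  fall n 2 * fall (n ∸ 2) k            ≡⟨ cong (_* fall (n ∸ 2) k) (C*!≡fall n 2) ⟨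
  (n C 2) * 2 * fall (n ∸ 2) k         ∎
  where
  open ≡-Reasoning
  regroup : ∀ x y z → x * (y * z) ≡ x * (y * 1) * z
  regroup = solve-∀

-- The number of sequences of m distinct elements taken alternately from two disjoint
-- pools of sizes p and q, starting with the first pool.
alternating : ℕ → ℕ → ℕ → ℕ
alternating zero p q = 1
alternating (suc m) p q = p * alternating m q (p ∸ 1)

alternating-vanishes : ∀ m p q → p + q < m → alternating m p q ≡ 0
alternating-vanishes (suc m) zero q _ = refl
alternating-vanishes (suc m) (suc p) q (s≤s p+q<m) =
  trans (cong (suc p *_) (alternating-vanishes m q p (subst (_< m) (+-comm p q) p+q<m))) (*-zeroʳ (suc p))

alternating-even : ∀ k p q → alternating (k * 2) p q ≡ fall p k * fall q k
alternating-even zero p q = refl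
alternating-even (suc k) p q = trans (cong (λ r → p * (q * r)) (alternating-even k (p ∸ 1) (q ∸ 1)))
                                     (regroup p q (fall (p ∸ 1) k) (fall (q ∸ 1) k))
  where
  regroup : ∀ p q x y → p * (q * (x * y)) ≡ p * x * (q * y)
  regroup = solve-∀

alternating-odd : ∀ k p q → alternating (suc (k * 2)) p q ≡ fall p (suc k) * fall q k
alternating-odd k p q = trans (cong (p *_) (alternating-even k q (p ∸ 1))) (regroup p (fall q k) (fall (p ∸ 1) k))
  where
  regroup : ∀ p x y → p * (x * y) ≡ p * y * x
  regroup = solve-∀

module _ {n : ℕ} where
  open ≡-Reasoning

  _∉ᵇ_ : Fin n → List (Fin n) → Bool
  v ∉ᵇ E = not (elemB v E)

  does-≟-sym : (x y : Fin n) → does (x ≟ y) ≡ does (y ≟ x)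
  does-≟-sym x y with x ≟ y
  ... | yes x≡y = sym (dec-true (y ≟ x) (sym x≡y))
  ... | no x≢y = sym (dec-false (y ≟ x) (x≢y ∘ sym))

  elemB-∷ : (x y : Fin n) (ys : List (Fin n)) → elemB x (y ∷ ys) ≡ does (x ≟ y) ∨ elemB x ys
  elemB-∷ x y ys with x ≟ y
  ... | yes _ = refl
  ... | no _ = refl

  elemB-middle : ∀ x ys y zs → elemB x (ys ++ y ∷ zs) ≡ elemB x (y ∷ ys ++ zs)
  elemB-middle x [] y zs = refl
  elemB-middle x (w ∷ ws) y zs = begin
    elemB x (w ∷ ws ++ y ∷ zs)                            ≡⟨ elemB-∷ x w (ws ++ y ∷ zs) ⟩
    does (x ≟ w) ∨ elemB x (ws ++ y ∷ zs)
      ≡⟨ cong (does (x ≟ w) ∨_) (trans (elemB-middle x ws y zs) (elemB-∷ x y (ws ++ zs))) ⟩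
    does (x ≟ w) ∨ (does (x ≟ y) ∨ elemB x (ws ++ zs))    ≡⟨ ∨-swap (does (x ≟ w)) (does (x ≟ y)) (elemB x (ws ++ zs)) ⟩
    does (x ≟ y) ∨ (does (x ≟ w) ∨ elemB x (ws ++ zs))    ≡⟨ cong (does (x ≟ y) ∨_) (elemB-∷ x w (ws ++ zs)) ⟨
    does (x ≟ y) ∨ elemB x (w ∷ ws ++ zs)                 ≡⟨ elemB-∷ x y (w ∷ ws ++ zs) ⟨
    elemB x (y ∷ w ∷ ws ++ zs)                            ∎

  ∉ᵇ-∷ʳ-self : ∀ x ys → x ∉ᵇ (ys ∷ʳ x) ≡ false
  ∉ᵇ-∷ʳ-self x ys = cong not (trans (elemB-middle x ys x [])
                      (trans (elemB-∷ x x (ys ++ [])) (cong (_∨ elemB x (ys ++ [])) (dec-true (x ≟ x) refl))))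

  all-∉ᵇ-∷ : ∀ t v E → all (_∉ᵇ (v ∷ E)) t ≡ v ∉ᵇ t ∧ all (_∉ᵇ E) t
  all-∉ᵇ-∷ [] v E = refl
  all-∉ᵇ-∷ (u ∷ t) v E = begin
    u ∉ᵇ (v ∷ E) ∧ all (_∉ᵇ (v ∷ E)) t
      ≡⟨ cong₂ _∧_ (cong not (elemB-∷ u v E)) (all-∉ᵇ-∷ t v E) ⟩
    not (does (u ≟ v) ∨ elemB u E) ∧ (v ∉ᵇ t ∧ all (_∉ᵇ E) t)
      ≡⟨ not-∨-swap (does (u ≟ v)) (elemB u E) (elemB v t) (all (_∉ᵇ E) t) ⟩
    not (does (u ≟ v) ∨ elemB v t) ∧ (u ∉ᵇ E ∧ all (_∉ᵇ E) t)
      ≡⟨ cong (λ d → not (d ∨ elemB v t) ∧ (u ∉ᵇ E ∧ all (_∉ᵇ E) t)) (does-≟-sym u v) ⟩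
    not (does (v ≟ u) ∨ elemB v t) ∧ (u ∉ᵇ E ∧ all (_∉ᵇ E) t)
      ≡⟨ cong (λ b → not b ∧ (u ∉ᵇ E ∧ all (_∉ᵇ E) t)) (elemB-∷ v u t) ⟨
    v ∉ᵇ (u ∷ t) ∧ all (_∉ᵇ E) (u ∷ t) ∎

  all-∉ᵇ-singleton : ∀ t x → all (_∉ᵇ (x ∷ [])) t ≡ x ∉ᵇ t
  all-∉ᵇ-singleton t x = trans (all-∉ᵇ-∷ t x []) (trans (cong (x ∉ᵇ t ∧_) (all-∉ᵇ-[] t)) (∧-identityʳ (x ∉ᵇ t)))
    where
    all-∉ᵇ-[] : ∀ t → all (_∉ᵇ []) t ≡ true
    all-∉ᵇ-[] [] = refl
    all-∉ᵇ-[] (_ ∷ t) = all-∉ᵇ-[] t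

  distinctB-middle : ∀ xs y zs → distinctB (xs ++ y ∷ zs) ≡ distinctB (y ∷ xs ++ zs)
  distinctB-middle [] y zs = refl
  distinctB-middle (w ∷ ws) y zs = begin
    w ∉ᵇ (ws ++ y ∷ zs) ∧ distinctB (ws ++ y ∷ zs)
      ≡⟨ cong₂ _∧_ (cong not (trans (elemB-middle w ws y zs) (elemB-∷ w y (ws ++ zs)))) (distinctB-middle ws y zs) ⟩
    not (does (w ≟ y) ∨ elemB w (ws ++ zs)) ∧ (y ∉ᵇ (ws ++ zs) ∧ distinctB (ws ++ zs))
      ≡⟨ not-∨-swap (does (w ≟ y)) (elemB w (ws ++ zs)) (elemB y (ws ++ zs)) (distinctB (ws ++ zs)) ⟩
    not (does (w ≟ y) ∨ elemB y (ws ++ zs)) ∧ (w ∉ᵇ (ws ++ zs) ∧ distinctB (ws ++ zs))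
      ≡⟨ cong (λ d → not (d ∨ elemB y (ws ++ zs)) ∧ (w ∉ᵇ (ws ++ zs) ∧ distinctB (ws ++ zs))) (does-≟-sym w y) ⟩
    not (does (y ≟ w) ∨ elemB y (ws ++ zs)) ∧ (w ∉ᵇ (ws ++ zs) ∧ distinctB (ws ++ zs))
      ≡⟨ cong (λ b → not b ∧ (w ∉ᵇ (ws ++ zs) ∧ distinctB (ws ++ zs))) (elemB-∷ y w (ws ++ zs)) ⟨
    distinctB (y ∷ w ∷ ws ++ zs) ∎

  distinctB-ʳ++ : ∀ xs ys → distinctB (xs ʳ++ ys) ≡ distinctB (xs ++ ys)
  distinctB-ʳ++ [] ys = refl
  distinctB-ʳ++ (x ∷ xs) ys = trans (distinctB-ʳ++ xs (x ∷ ys)) (distinctB-middle xs x ys)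

  distinctB-reverse : ∀ xs → distinctB (reverse xs) ≡ distinctB xs
  distinctB-reverse xs = trans (distinctB-ʳ++ xs []) (cong distinctB (++-identityʳ xs))

  lastOr-∷ʳ : ∀ d xs (y : Fin n) → lastOr d (xs ∷ʳ y) ≡ y
  lastOr-∷ʳ d [] y = refl
  lastOr-∷ʳ d (x ∷ xs) y = lastOr-∷ʳ x xs y

  canonical-ends : ∀ x ys y → canonical (x ∷ (ys ∷ʳ y)) ≡ (toℕ x <ᵇ toℕ y)
  canonical-ends x [] y = refl
  canonical-ends x (z ∷ zs) y = cong (λ w → toℕ x <ᵇ toℕ w) (lastOr-∷ʳ z zs y)

  reverse-ends : ∀ (x : Fin n) ys y → reverse (x ∷ (ys ∷ʳ y)) ≡ y ∷ (reverse ys ∷ʳ x)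
  reverse-ends x ys y = trans (unfold-reverse x (ys ∷ʳ y)) (cong (_∷ʳ x) (reverse-++ ys (y ∷ [])))

  sumLists : ℕ → (List (Fin n) → ℕ) → ℕ
  sumLists zero w = w []
  sumLists (suc L) w = ∑[ v < n ] sumLists L (λ t → w (v ∷ t))

  sumLists-cong : ∀ L {w w′ : List (Fin n) → ℕ} → (∀ t → w t ≡ w′ t) → sumLists L w ≡ sumLists L w′
  sumLists-cong zero w≡w′ = w≡w′ []
  sumLists-cong (suc L) w≡w′ = sum-cong-≗ (λ v → sumLists-cong L (λ t → w≡w′ (v ∷ t)))

  sumLists-*ˡ : ∀ L c (w : List (Fin n) → ℕ) → sumLists L (λ t → c * w t) ≡ c * sumLists L w
  sumLists-*ˡ zero c w = refl
  sumLists-*ˡ (suc L) c w = begin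
    ∑[ v < n ] sumLists L (λ t → c * w (v ∷ t))     ≡⟨ sum-cong-≗ (λ v → sumLists-*ˡ L c (λ t → w (v ∷ t))) ⟩
    ∑[ v < n ] (c * sumLists L (λ t → w (v ∷ t)))   ≡⟨ *-distribˡ-sum c (λ v → sumLists L (λ t → w (v ∷ t))) ⟨
    c * sumLists (suc L) w                           ∎

  sumLists-+ : ∀ L (w w′ : List (Fin n) → ℕ) → sumLists L (λ t → w t + w′ t) ≡ sumLists L w + sumLists L w′
  sumLists-+ zero w w′ = refl
  sumLists-+ (suc L) w w′ = begin
    ∑[ v < n ] sumLists L (λ t → w (v ∷ t) + w′ (v ∷ t))
      ≡⟨ sum-cong-≗ (λ v → sumLists-+ L (λ t → w (v ∷ t)) (λ t → w′ (v ∷ t))) ⟩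
    ∑[ v < n ] (sumLists L (λ t → w (v ∷ t)) + sumLists L (λ t → w′ (v ∷ t)))
      ≡⟨ ∑-distrib-+ (λ v → sumLists L (λ t → w (v ∷ t))) (λ v → sumLists L (λ t → w′ (v ∷ t))) ⟩
    sumLists (suc L) w + sumLists (suc L) w′ ∎

  sumLists-∷ʳ : ∀ L (w : List (Fin n) → ℕ) → sumLists (suc L) w ≡ ∑[ v < n ] sumLists L (λ t → w (t ∷ʳ v))
  sumLists-∷ʳ zero w = refl
  sumLists-∷ʳ (suc L) w = begin
    ∑[ u < n ] sumLists (suc L) (λ t → w (u ∷ t))              ≡⟨ sum-cong-≗ (λ u → sumLists-∷ʳ L (λ t → w (u ∷ t))) ⟩
    ∑[ u < n ] ∑[ v < n ] sumLists L (λ t → w (u ∷ (t ∷ʳ v)))  ≡⟨ ∑-comm (λ u v → sumLists L (λ t → w (u ∷ (t ∷ʳ v)))) ⟩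
    ∑[ v < n ] ∑[ u < n ] sumLists L (λ t → w (u ∷ (t ∷ʳ v)))  ∎

  sumLists-reverse : ∀ L (w : List (Fin n) → ℕ) → sumLists L (λ t → w (reverse t)) ≡ sumLists L w
  sumLists-reverse zero w = refl
  sumLists-reverse (suc L) w = begin
    ∑[ v < n ] sumLists L (λ t → w (reverse (v ∷ t)))
      ≡⟨ sum-cong-≗ (λ v → sumLists-cong L (λ t → cong w (unfold-reverse v t))) ⟩
    ∑[ v < n ] sumLists L (λ t → w (reverse t ∷ʳ v))    ≡⟨ sum-cong-≗ (λ v → sumLists-reverse L (λ t → w (t ∷ʳ v))) ⟩
    ∑[ v < n ] sumLists L (λ t → w (t ∷ʳ v))            ≡⟨ sumLists-∷ʳ L w ⟨
    sumLists (suc L) w                                  ∎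

  sumLists-cong-ends : ∀ L {w w′ : List (Fin n) → ℕ} → (∀ x ys y → w (x ∷ (ys ∷ʳ y)) ≡ w′ (x ∷ (ys ∷ʳ y))) →
                       sumLists (suc (suc L)) w ≡ sumLists (suc (suc L)) w′
  sumLists-cong-ends L {w} {w′} w≡w′ = sum-cong-≗ (λ x → begin
    sumLists (suc L) (λ t → w (x ∷ t))                   ≡⟨ sumLists-∷ʳ L (λ t → w (x ∷ t)) ⟩
    ∑[ y < n ] sumLists L (λ ys → w (x ∷ (ys ∷ʳ y)))     ≡⟨ sum-cong-≗ (λ y → sumLists-cong L (λ ys → w≡w′ x ys y)) ⟩
    ∑[ y < n ] sumLists L (λ ys → w′ (x ∷ (ys ∷ʳ y)))    ≡⟨ sumLists-∷ʳ L (λ t → w′ (x ∷ t)) ⟨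
    sumLists (suc L) (λ t → w′ (x ∷ t))                  ∎)

  length-filterᵇ-allLists : ∀ L p → length (filterᵇ p (allLists L)) ≡ sumLists L (λ t → ⟦ p t ⟧)
  length-filterᵇ-allLists zero p = trans (length-filterᵇ-∷ p [] []) (+-identityʳ ⟦ p [] ⟧)
  length-filterᵇ-allLists (suc L) p = begin
    length (filterᵇ p (concatMap (λ v → map (v ∷_) (allLists L)) (allFin n)))
      ≡⟨ length-filterᵇ-concatMap p (λ v → map (v ∷_) (allLists L)) (allFin n) ⟩
    sumList (map (λ v → length (filterᵇ p (map (v ∷_) (allLists L)))) (allFin n))
      ≡⟨ sumList-tabulate (λ v → length (filterᵇ p (map (v ∷_) (allLists L)))) (λ v → v) ⟩
    ∑[ v < n ] length (filterᵇ p (map (v ∷_) (allLists L)))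
      ≡⟨ sum-cong-≗ (λ v → trans (length-filterᵇ-map p (v ∷_) (allLists L)) (length-filterᵇ-allLists L (p ∘ (v ∷_)))) ⟩
    sumLists (suc L) (λ t → ⟦ p t ⟧) ∎

module _ {n : ℕ} (G : Graph n) where
  open ≡-Reasoning

  pathsOfLength pathSeqsOfLength : ℕ → ℕ
  pathsOfLength l = sumLists (suc l) (λ t → ⟦ isPathSeq G t ∧ canonical t ⟧)
  pathSeqsOfLength l = sumLists (suc l) (λ t → ⟦ isPathSeq G t ⟧)

  pn≡∑pathsOfLength : pn G ≡ ∑[ l < n ] pathsOfLength (toℕ l)
  pn≡∑pathsOfLength = begin
    length (filterᵇ P (concatMap allLists (upTo (suc n))))
      ≡⟨ length-filterᵇ-concatMap P allLists (upTo (suc n)) ⟩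
    sumList (map (λ L → length (filterᵇ P (allLists L))) (upTo (suc n)))
      ≡⟨ sumList-applyUpTo (λ L → length (filterᵇ P (allLists L))) (λ L → L) (suc n) ⟩
    ∑[ L < suc n ] length (filterᵇ P (allLists (toℕ L)))
      ≡⟨ sum-cong-≗ {suc n} (λ L → length-filterᵇ-allLists (toℕ L) P) ⟩
    ∑[ L < suc n ] sumLists (toℕ L) (λ t → ⟦ P t ⟧) ∎
    where
    P : List (Fin n) → Bool
    P t = isPathSeq G t ∧ canonical t

  module _ (G-sym : ∀ u v → G u v ≡ G v u) where

    adjChain-ʳ++ : ∀ xs y ys → adjChain G (xs ʳ++ (y ∷ ys)) ≡ adjChain G (y ∷ xs) ∧ adjChain G (y ∷ ys)
    adjChain-ʳ++ [] y ys = refl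
    adjChain-ʳ++ (x ∷ xs) y ys = begin
      adjChain G (xs ʳ++ (x ∷ y ∷ ys))                        ≡⟨ adjChain-ʳ++ xs x (y ∷ ys) ⟩
      adjChain G (x ∷ xs) ∧ (G x y ∧ adjChain G (y ∷ ys))
        ≡⟨ cong (λ b → adjChain G (x ∷ xs) ∧ (b ∧ adjChain G (y ∷ ys))) (G-sym x y) ⟩
      adjChain G (x ∷ xs) ∧ (G y x ∧ adjChain G (y ∷ ys))
        ≡⟨ regroup (adjChain G (x ∷ xs)) (G y x) (adjChain G (y ∷ ys)) ⟩
      (G y x ∧ adjChain G (x ∷ xs)) ∧ adjChain G (y ∷ ys)     ∎
      where
      open ∧-Solver
      regroup : ∀ p q r → p ∧ (q ∧ r) ≡ (q ∧ p) ∧ r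
      regroup = solve 3 (λ p q r → p ⊕ (q ⊕ r) ⊜ (q ⊕ p) ⊕ r) refl

    isPathSeq-ʳ++ : ∀ xs y ys → isPathSeq G (xs ʳ++ (y ∷ ys)) ≡ distinctB (xs ʳ++ (y ∷ ys)) ∧ adjChain G (xs ʳ++ (y ∷ ys))
    isPathSeq-ʳ++ [] y ys = refl
    isPathSeq-ʳ++ (x ∷ xs) y ys = isPathSeq-ʳ++ xs x (y ∷ ys)

    isPathSeq-reverse : ∀ t → isPathSeq G (reverse t) ≡ isPathSeq G t
    isPathSeq-reverse [] = refl
    isPathSeq-reverse (x ∷ xs) = trans (isPathSeq-ʳ++ xs x [])
      (cong₂ _∧_ (distinctB-reverse (x ∷ xs)) (trans (adjChain-ʳ++ xs x []) (∧-identityʳ (adjChain G (x ∷ xs)))))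

    canonical-or-reverse-canonical : ∀ x ys y → let t = x ∷ (ys ∷ʳ y) in
      ⟦ isPathSeq G t ∧ canonical t ⟧ + ⟦ isPathSeq G t ∧ canonical (reverse t) ⟧ ≡ ⟦ isPathSeq G t ⟧
    canonical-or-reverse-canonical x ys y with isPathSeq G (x ∷ (ys ∷ʳ y)) in path
    ... | false = refl
    ... | true = begin
      ⟦ canonical (x ∷ (ys ∷ʳ y)) ⟧ + ⟦ canonical (reverse (x ∷ (ys ∷ʳ y))) ⟧
        ≡⟨ cong₂ (λ c c′ → ⟦ c ⟧ + ⟦ c′ ⟧) (canonical-ends x ys y)
                 (trans (cong canonical (reverse-ends x ys y)) (canonical-ends y (reverse ys) x)) ⟩
      ⟦ toℕ x <ᵇ toℕ y ⟧ + ⟦ toℕ y <ᵇ toℕ x ⟧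
        ≡⟨ ⟦<ᵇ⟧-connex (x≢y ∘ toℕ-injective) ⟩
      1 ∎
      where
      x≢y : x ≢ y
      x≢y refl with () ← trans (sym (∉ᵇ-∷ʳ-self x ys)) (∧-conicalˡ _ _ (∧-conicalˡ _ _ path))

    -- Reversal permutes the vertex lists of each length, preserves being a path and,
    -- on lists with distinct ends, exchanges canonical and non-canonical.
    pathsOfLength-double : ∀ L → pathsOfLength (suc L) + pathsOfLength (suc L) ≡ pathSeqsOfLength (suc L)
    pathsOfLength-double L = begin
      S (λ t → ⟦ P t ∧ canonical t ⟧) + S (λ t → ⟦ P t ∧ canonical t ⟧)
        ≡⟨ cong (S (λ t → ⟦ P t ∧ canonical t ⟧) +_) (sumLists-reverse (suc (suc L)) (λ t → ⟦ P t ∧ canonical t ⟧)) ⟨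
      S (λ t → ⟦ P t ∧ canonical t ⟧) + S (λ t → ⟦ P (reverse t) ∧ canonical (reverse t) ⟧)
        ≡⟨ cong (S (λ t → ⟦ P t ∧ canonical t ⟧) +_)
                (sumLists-cong (suc (suc L)) (λ t → cong (λ b → ⟦ b ∧ canonical (reverse t) ⟧) (isPathSeq-reverse t))) ⟩
      S (λ t → ⟦ P t ∧ canonical t ⟧) + S (λ t → ⟦ P t ∧ canonical (reverse t) ⟧)
        ≡⟨ sumLists-+ (suc (suc L)) (λ t → ⟦ P t ∧ canonical t ⟧) (λ t → ⟦ P t ∧ canonical (reverse t) ⟧) ⟨
      S (λ t → ⟦ P t ∧ canonical t ⟧ + ⟦ P t ∧ canonical (reverse t) ⟧)
        ≡⟨ sumLists-cong-ends L {λ t → ⟦ P t ∧ canonical t ⟧ + ⟦ P t ∧ canonical (reverse t) ⟧} {λ t → ⟦ P t ⟧}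
                              canonical-or-reverse-canonical ⟩
      S (λ t → ⟦ P t ⟧) ∎
      where
      P : List (Fin n) → Bool
      P = isPathSeq G
      S : (List (Fin n) → ℕ) → ℕ
      S = sumLists (suc (suc L))

module CompleteBipartite {n : ℕ} (c : Fin n → Bool) (G : Graph n) (G≡xor : ∀ u v → G u v ≡ c u xor c v) where
  open ≡-Reasoning

  hasColour : Bool → Fin n → Bool
  hasColour true v = c v
  hasColour false v = not (c v)

  hasColour-own : ∀ v → hasColour (c v) v ≡ true
  hasColour-own v with c v in cv
  ... | true = cv
  ... | false = cong not cv

  hasColour-other : ∀ v → hasColour (not (c v)) v ≡ false
  hasColour-other v with c v in cv
  ... | true = cong not cv
  ... | false = cv

  adjacent≡opposite : ∀ u v → G u v ≡ hasColour (not (c u)) v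
  adjacent≡opposite u v with c u | G≡xor u v
  ... | true | eq = eq
  ... | false | eq = eq

  adjacent⇒opposite : ∀ u v → G u v ≡ true → c v ≡ not (c u)
  adjacent⇒opposite u v adj with c u | c v | trans (sym (G≡xor u v)) adj
  ... | true | false | _ = refl
  ... | false | true | _ = refl

  colourClass : Bool → ℕ
  colourClass s = ∑[ v < n ] ⟦ hasColour s v ⟧

  ∑-by-colour : ∀ (f : Bool → ℕ) → ∑[ v < n ] f (c v) ≡ colourClass true * f true + colourClass false * f false
  ∑-by-colour f = begin
    ∑[ v < n ] f (c v)
      ≡⟨ sum-cong-≗ split ⟩
    ∑[ v < n ] (⟦ c v ⟧ * f true + ⟦ not (c v) ⟧ * f false)
      ≡⟨ ∑-distrib-+ (λ v → ⟦ c v ⟧ * f true) (λ v → ⟦ not (c v) ⟧ * f false) ⟩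
    ∑[ v < n ] (⟦ c v ⟧ * f true) + ∑[ v < n ] (⟦ not (c v) ⟧ * f false)
      ≡⟨ cong₂ _+_ (*-distribʳ-sum (f true) (λ v → ⟦ c v ⟧)) (*-distribʳ-sum (f false) (λ v → ⟦ not (c v) ⟧)) ⟨
    colourClass true * f true + colourClass false * f false ∎
    where
    split : ∀ v → f (c v) ≡ ⟦ c v ⟧ * f true + ⟦ not (c v) ⟧ * f false
    split v with c v
    ... | true = sym (trans (+-identityʳ (f true + 0)) (+-identityʳ (f true)))
    ... | false = sym (+-identityʳ (f false))

  free : List (Fin n) → Bool → ℕ
  free E s = ∑[ v < n ] ⟦ v ∉ᵇ E ∧ hasColour s v ⟧

  free-∷ : ∀ v E s → free (v ∷ E) s + ⟦ v ∉ᵇ E ∧ hasColour s v ⟧ ≡ free E s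
  free-∷ v E s = begin
    free (v ∷ E) s + ⟦ v ∉ᵇ E ∧ hasColour s v ⟧
      ≡⟨ cong (free (v ∷ E) s +_) (∑-δ v (λ u → ⟦ u ∉ᵇ E ∧ hasColour s u ⟧)) ⟨
    free (v ∷ E) s + ∑[ u < n ] (⟦ does (u ≟ v) ⟧ * ⟦ u ∉ᵇ E ∧ hasColour s u ⟧)
      ≡⟨ ∑-distrib-+ (λ u → ⟦ u ∉ᵇ (v ∷ E) ∧ hasColour s u ⟧)
                     (λ u → ⟦ does (u ≟ v) ⟧ * ⟦ u ∉ᵇ E ∧ hasColour s u ⟧) ⟨
    ∑[ u < n ] (⟦ u ∉ᵇ (v ∷ E) ∧ hasColour s u ⟧ + ⟦ does (u ≟ v) ⟧ * ⟦ u ∉ᵇ E ∧ hasColour s u ⟧)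
      ≡⟨ sum-cong-≗ split ⟩
    free E s ∎
    where
    split : ∀ u → ⟦ u ∉ᵇ (v ∷ E) ∧ hasColour s u ⟧ + ⟦ does (u ≟ v) ⟧ * ⟦ u ∉ᵇ E ∧ hasColour s u ⟧
                ≡ ⟦ u ∉ᵇ E ∧ hasColour s u ⟧
    split u rewrite elemB-∷ u v E with does (u ≟ v)
    ... | true = +-identityʳ _
    ... | false = +-identityʳ _

  free-∷-fresh : ∀ {v E} s → v ∉ᵇ E ≡ true → free (v ∷ E) s ≡ free E s ∸ ⟦ hasColour s v ⟧
  free-∷-fresh {v} {E} s fresh = begin
    free (v ∷ E) s
      ≡⟨ m+n∸n≡m (free (v ∷ E) s) ⟦ v ∉ᵇ E ∧ hasColour s v ⟧ ⟨
    free (v ∷ E) s + ⟦ v ∉ᵇ E ∧ hasColour s v ⟧ ∸ ⟦ v ∉ᵇ E ∧ hasColour s v ⟧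
      ≡⟨ cong₂ _∸_ (free-∷ v E s) (cong (λ b → ⟦ b ∧ hasColour s v ⟧) fresh) ⟩
    free E s ∸ ⟦ hasColour s v ⟧ ∎

  isPathExtension : List (Fin n) → Fin n → List (Fin n) → Bool
  isPathExtension E p t = all (_∉ᵇ E) t ∧ (distinctB t ∧ adjChain G (p ∷ t))

  isPathExtension-∷ : ∀ E p v t → isPathExtension E p (v ∷ t) ≡ (v ∉ᵇ E ∧ G p v) ∧ isPathExtension (v ∷ E) v t
  isPathExtension-∷ E p v t = begin
    (v ∉ᵇ E ∧ all (_∉ᵇ E) t) ∧ ((v ∉ᵇ t ∧ distinctB t) ∧ (G p v ∧ adjChain G (v ∷ t)))
      ≡⟨ regroup (v ∉ᵇ E) (all (_∉ᵇ E) t) (v ∉ᵇ t) (distinctB t) (G p v) (adjChain G (v ∷ t)) ⟩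
    (v ∉ᵇ E ∧ G p v) ∧ ((v ∉ᵇ t ∧ all (_∉ᵇ E) t) ∧ (distinctB t ∧ adjChain G (v ∷ t)))
      ≡⟨ cong (λ b → (v ∉ᵇ E ∧ G p v) ∧ (b ∧ (distinctB t ∧ adjChain G (v ∷ t)))) (all-∉ᵇ-∷ t v E) ⟨
    (v ∉ᵇ E ∧ G p v) ∧ isPathExtension (v ∷ E) v t ∎
    where
    open ∧-Solver
    regroup : ∀ a b c d e f → (a ∧ b) ∧ ((c ∧ d) ∧ (e ∧ f)) ≡ (a ∧ e) ∧ ((c ∧ b) ∧ (d ∧ f))
    regroup = solve 6 (λ a b c d e f → (a ⊕ b) ⊕ ((c ⊕ d) ⊕ (e ⊕ f)) ⊜ (a ⊕ e) ⊕ ((c ⊕ b) ⊕ (d ⊕ f))) refl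

  pathExtensions-count : ∀ l E p →
    sumLists l (λ t → ⟦ isPathExtension E p t ⟧) ≡ alternating l (free E (not (c p))) (free E (c p))
  pathExtensions-count zero E p = refl
  pathExtensions-count (suc l) E p = begin
    ∑[ v < n ] sumLists l (λ t → ⟦ isPathExtension E p (v ∷ t) ⟧)
      ≡⟨ sum-cong-≗ (λ v → sumLists-cong l (λ t →
           trans (cong ⟦_⟧ (isPathExtension-∷ E p v t)) (⟦∧⟧ (v ∉ᵇ E ∧ G p v) (isPathExtension (v ∷ E) v t)))) ⟩
    ∑[ v < n ] sumLists l (λ t → ⟦ v ∉ᵇ E ∧ G p v ⟧ * ⟦ isPathExtension (v ∷ E) v t ⟧)
      ≡⟨ sum-cong-≗ (λ v → sumLists-*ˡ l ⟦ v ∉ᵇ E ∧ G p v ⟧ (λ t → ⟦ isPathExtension (v ∷ E) v t ⟧)) ⟩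
    ∑[ v < n ] (⟦ v ∉ᵇ E ∧ G p v ⟧ * sumLists l (λ t → ⟦ isPathExtension (v ∷ E) v t ⟧))
      ≡⟨ sum-cong-≗ (λ v → ⟦⟧*-cong (v ∉ᵇ E ∧ G p v) (step v)) ⟩
    ∑[ v < n ] (⟦ v ∉ᵇ E ∧ G p v ⟧ * R)
      ≡⟨ *-distribʳ-sum R (λ v → ⟦ v ∉ᵇ E ∧ G p v ⟧) ⟨
    ∑[ v < n ] ⟦ v ∉ᵇ E ∧ G p v ⟧ * R
      ≡⟨ cong (_* R) (sum-cong-≗ (λ v → cong (λ b → ⟦ v ∉ᵇ E ∧ b ⟧) (adjacent≡opposite p v))) ⟩
    free E (not (c p)) * R ∎
    where
    R : ℕ
    R = alternating l (free E (c p)) (free E (not (c p)) ∸ 1)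

    -- After stepping to a fresh neighbour v the two pools exchange roles, and v's pool loses v.
    step : ∀ v → v ∉ᵇ E ∧ G p v ≡ true → sumLists l (λ t → ⟦ isPathExtension (v ∷ E) v t ⟧) ≡ R
    step v fresh∧adjacent = trans (pathExtensions-count l (v ∷ E) v) (cong₂ (alternating l) other-pool own-pool)
      where
      fresh : v ∉ᵇ E ≡ true
      fresh = ∧-conicalˡ _ _ fresh∧adjacent
      opposite : c v ≡ not (c p)
      opposite = adjacent⇒opposite p v (∧-conicalʳ _ _ fresh∧adjacent)
      other-pool : free (v ∷ E) (not (c v)) ≡ free E (c p)
      other-pool = begin
        free (v ∷ E) (not (c v))                          ≡⟨ free-∷-fresh {v} {E} (not (c v)) fresh ⟩
        free E (not (c v)) ∸ ⟦ hasColour (not (c v)) v ⟧  ≡⟨ cong (λ b → free E (not (c v)) ∸ ⟦ b ⟧) (hasColour-other v) ⟩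
        free E (not (c v))
          ≡⟨ cong (free E) (trans (cong not opposite) (not-involutive (c p))) ⟩
        free E (c p)                                      ∎
      own-pool : free (v ∷ E) (c v) ≡ free E (not (c p)) ∸ 1
      own-pool = begin
        free (v ∷ E) (c v)                    ≡⟨ free-∷-fresh {v} {E} (c v) fresh ⟩
        free E (c v) ∸ ⟦ hasColour (c v) v ⟧  ≡⟨ cong₂ (λ s b → free E s ∸ ⟦ b ⟧) opposite (hasColour-own v) ⟩
        free E (not (c p)) ∸ 1                ∎

  isPathSeq≡isPathExtension : ∀ x t → isPathSeq G (x ∷ t) ≡ isPathExtension (x ∷ []) x t
  isPathSeq≡isPathExtension x t = begin
    (x ∉ᵇ t ∧ distinctB t) ∧ adjChain G (x ∷ t)                ≡⟨ ∧-assoc (x ∉ᵇ t) (distinctB t) (adjChain G (x ∷ t)) ⟩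
    x ∉ᵇ t ∧ (distinctB t ∧ adjChain G (x ∷ t))
      ≡⟨ cong (_∧ (distinctB t ∧ adjChain G (x ∷ t))) (all-∉ᵇ-singleton t x) ⟨
    all (_∉ᵇ (x ∷ [])) t ∧ (distinctB t ∧ adjChain G (x ∷ t))  ∎

  pathSeqsOfLength-count : ∀ l → pathSeqsOfLength G l ≡
    alternating (suc l) (colourClass true) (colourClass false) + alternating (suc l) (colourClass false) (colourClass true)
  pathSeqsOfLength-count l = begin
    ∑[ x < n ] sumLists l (λ t → ⟦ isPathSeq G (x ∷ t) ⟧)
      ≡⟨ sum-cong-≗ (λ x → sumLists-cong l (λ t → cong ⟦_⟧ (isPathSeq≡isPathExtension x t))) ⟩
    ∑[ x < n ] sumLists l (λ t → ⟦ isPathExtension (x ∷ []) x t ⟧)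
      ≡⟨ sum-cong-≗ (λ x → pathExtensions-count l (x ∷ []) x) ⟩
    ∑[ x < n ] alternating l (free (x ∷ []) (not (c x))) (free (x ∷ []) (c x))
      ≡⟨ sum-cong-≗ (λ x → cong₂ (alternating l) (other-pool x) (own-pool x)) ⟩
    ∑[ x < n ] F (c x)
      ≡⟨ ∑-by-colour F ⟩
    colourClass true * F true + colourClass false * F false ∎
    where
    F : Bool → ℕ
    F s = alternating l (colourClass (not s)) (colourClass s ∸ 1)
    other-pool : ∀ x → free (x ∷ []) (not (c x)) ≡ colourClass (not (c x))
    other-pool x = trans (free-∷-fresh {x} {[]} (not (c x)) refl)
                         (cong (λ b → colourClass (not (c x)) ∸ ⟦ b ⟧) (hasColour-other x))
    own-pool : ∀ x → free (x ∷ []) (c x) ≡ colourClass (c x) ∸ 1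
    own-pool x = trans (free-∷-fresh {x} {[]} (c x) refl) (cong (λ b → colourClass (c x) ∸ ⟦ b ⟧) (hasColour-own x))

K≡xor : ∀ a b u v → K a b u v ≡ side a u xor side a v
K≡xor a b u v with side a u | side a v
... | true | true = refl
... | true | false = refl
... | false | true = refl
... | false | false = refl

K-sym : ∀ a b u v → K a b u v ≡ K a b v u
K-sym a b u v = trans (K≡xor a b u v) (trans (xor-comm (side a u) (side a v)) (sym (K≡xor a b v u)))

∑-below : ∀ a b → ∑[ v < a + b ] ⟦ toℕ v <ᵇ a ⟧ ≡ a
∑-below zero b = ∑-0 b
∑-below (suc a) b = cong suc (∑-below a b)

∑-not-below : ∀ a b → ∑[ v < a + b ] ⟦ not (toℕ v <ᵇ a) ⟧ ≡ b
∑-not-below zero b = ∑-1 b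
∑-not-below (suc a) b = ∑-not-below a b

module PathsOfK (a b : ℕ) where
  open CompleteBipartite (side a) (K a b) (K≡xor a b)
  open ≡-Reasoning

  paths : ℕ → ℕ
  paths = pathsOfLength (K a b)

  -- The summands of the three sums of the formula, with k shifted to start at 0.
  X₁ X₂ X₃ : ℕ → ℕ
  X₁ k = fall b (suc k) * fall (a ∸ 2) k
  X₂ k = fall a (suc k) * fall (b ∸ 2) k
  X₃ k = fall (a ∸ 1) k * fall (b ∸ 1) k

  paths-zero : paths 0 ≡ a + b
  paths-zero = ∑-1 (a + b)

  paths-double : ∀ m → paths (suc m) + paths (suc m) ≡ alternating (suc (suc m)) a b + alternating (suc (suc m)) b a
  paths-double m = begin
    paths (suc m) + paths (suc m)              ≡⟨ pathsOfLength-double (K a b) (K-sym a b) m ⟩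
    pathSeqsOfLength (K a b) (suc m)           ≡⟨ pathSeqsOfLength-count (suc m) ⟩
    alternating (suc (suc m)) (colourClass true) (colourClass false)
      + alternating (suc (suc m)) (colourClass false) (colourClass true)
      ≡⟨ cong₂ (λ p q → alternating (suc (suc m)) p q + alternating (suc (suc m)) q p) (∑-below a b) (∑-not-below a b) ⟩
    alternating (suc (suc m)) a b + alternating (suc (suc m)) b a ∎

  paths-vanish : ∀ l → a + b ≤ l → paths l ≡ 0
  paths-vanish zero a+b≤0 = trans paths-zero (n≤0⇒n≡0 a+b≤0)
  paths-vanish (suc m) a+b≤1+m = +-self-injective (trans (paths-double m) (cong₂ _+_
    (alternating-vanishes (suc (suc m)) a b (s≤s a+b≤1+m))
    (alternating-vanishes (suc (suc m)) b a (s≤s (subst (_≤ suc m) (+-comm a b) a+b≤1+m)))))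

  paths-odd : ∀ k → paths (suc (k * 2)) ≡ a * b * X₃ k
  paths-odd k = +-self-injective (begin
    paths (suc (k * 2)) + paths (suc (k * 2))                  ≡⟨ paths-double (k * 2) ⟩
    alternating (suc k * 2) a b + alternating (suc k * 2) b a
      ≡⟨ cong₂ _+_ (alternating-even (suc k) a b) (alternating-even (suc k) b a) ⟩
    fall a (suc k) * fall b (suc k) + fall b (suc k) * fall a (suc k)
      ≡⟨ regroup a b (fall (a ∸ 1) k) (fall (b ∸ 1) k) ⟩
    a * b * X₃ k + a * b * X₃ k ∎)
    where
    regroup : ∀ a b x y → a * x * (b * y) + b * y * (a * x) ≡ a * b * (x * y) + a * b * (x * y)
    regroup = solve-∀

  paths-even : ∀ k → paths (suc (suc (k * 2))) ≡ (a C 2) * X₁ k + (b C 2) * X₂ k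
  paths-even k = +-self-injective (begin
    paths (suc (suc (k * 2))) + paths (suc (suc (k * 2)))
      ≡⟨ paths-double (suc (k * 2)) ⟩
    alternating (suc (suc k * 2)) a b + alternating (suc (suc k * 2)) b a
      ≡⟨ cong₂ _+_ (alternating-odd (suc k) a b) (alternating-odd (suc k) b a) ⟩
    fall a (suc (suc k)) * fall b (suc k) + fall b (suc (suc k)) * fall a (suc k)
      ≡⟨ cong₂ (λ x y → x * fall b (suc k) + y * fall a (suc k)) (fall-suc-suc a k) (fall-suc-suc b k) ⟩
    (a C 2) * 2 * fall (a ∸ 2) k * fall b (suc k) + (b C 2) * 2 * fall (b ∸ 2) k * fall a (suc k)
      ≡⟨ regroup (a C 2) (b C 2) (fall (a ∸ 2) k) (fall b (suc k)) (fall (b ∸ 2) k) (fall a (suc k)) ⟩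
    ((a C 2) * X₁ k + (b C 2) * X₂ k) + ((a C 2) * X₁ k + (b C 2) * X₂ k) ∎)
    where
    regroup : ∀ A B x y z w → A * 2 * x * y + B * 2 * z * w ≡ (A * (y * x) + B * (w * z)) + (A * (y * x) + B * (w * z))
    regroup = solve-∀

  module _ (1≤a : 1 ≤ a) where

    X₁-vanishes : ∀ k → a ≤ k → X₁ k ≡ 0
    X₁-vanishes k a≤k = trans (cong (fall b (suc k) *_) (fall-vanishes (<-≤-trans (m∸[1+n]<m 1 1≤a) a≤k)))
                              (*-zeroʳ (fall b (suc k)))

    X₂-vanishes : ∀ k → a ≤ k → X₂ k ≡ 0
    X₂-vanishes k a≤k = cong (_* fall (b ∸ 2) k) (fall-vanishes (s≤s a≤k))

    X₃-vanishes : ∀ k → a ≤ k → X₃ k ≡ 0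
    X₃-vanishes k a≤k = cong (_* fall (b ∸ 1) k) (fall-vanishes (<-≤-trans (m∸[1+n]<m 0 1≤a) a≤k))

    pnFormula≡∑ : pnFormula a b ≡
                  a + b + ∑[ k < a + b ] (a * b * X₃ (toℕ k) + ((a C 2) * X₁ (toℕ k) + (b C 2) * X₂ (toℕ k)))
    pnFormula≡∑ = begin
      (a C 2) * sumFrom1 a f₁ + (b C 2) * sumFrom1 (suc a) f₂ + a * b * sumFrom1 a f₃ + (a + b)
        ≡⟨ cong₂ (λ s₁ s₂ → (a C 2) * s₁ + (b C 2) * s₂ + a * b * sumFrom1 a f₃ + (a + b))
                 (truncated f₁ X₁ (λ i → C*!-product b (suc i) (a ∸ 2) i) X₁-vanishes ≤-refl)
                 (truncated f₂ X₂ (λ i → C*!-product a (suc i) (b ∸ 2) i) X₂-vanishes (n≤1+n a)) ⟩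
      (a C 2) * ∑X₁ + (b C 2) * ∑X₂ + a * b * sumFrom1 a f₃ + (a + b)
        ≡⟨ cong (λ s₃ → (a C 2) * ∑X₁ + (b C 2) * ∑X₂ + a * b * s₃ + (a + b))
                (truncated f₃ X₃ (λ i → C*!-product (a ∸ 1) i (b ∸ 1) i) X₃-vanishes ≤-refl) ⟩
      (a C 2) * ∑X₁ + (b C 2) * ∑X₂ + a * b * ∑X₃ + (a + b)
        ≡⟨ regroup (a C 2) (b C 2) (a * b) (a + b) ∑X₁ ∑X₂ ∑X₃ ⟩
      a + b + (a * b * ∑X₃ + ((a C 2) * ∑X₁ + (b C 2) * ∑X₂))
        ≡⟨ cong (a + b +_) (∑-linear₃ {a + b} (a * b) (a C 2) (b C 2) (X₃ ∘ toℕ) (X₁ ∘ toℕ) (X₂ ∘ toℕ)) ⟨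
      a + b + ∑[ k < a + b ] (a * b * X₃ (toℕ k) + ((a C 2) * X₁ (toℕ k) + (b C 2) * X₂ (toℕ k))) ∎
      where
      f₁ f₂ f₃ : ℕ → ℕ
      f₁ k = (b C k) * k ! * ((a ∸ 2) C (k ∸ 1)) * (k ∸ 1) !
      f₂ k = (a C k) * k ! * ((b ∸ 2) C (k ∸ 1)) * (k ∸ 1) !
      f₃ k = ((a ∸ 1) C (k ∸ 1)) * (k ∸ 1) ! * ((b ∸ 1) C (k ∸ 1)) * (k ∸ 1) !
      ∑X₁ ∑X₂ ∑X₃ : ℕ
      ∑X₁ = ∑[ k < a + b ] X₁ (toℕ k)
      ∑X₂ = ∑[ k < a + b ] X₂ (toℕ k)
      ∑X₃ = ∑[ k < a + b ] X₃ (toℕ k)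
      truncated : ∀ {m} (f X : ℕ → ℕ) → (∀ i → f (suc i) ≡ X i) → (∀ k → a ≤ k → X k ≡ 0) → a ≤ m →
                  sumFrom1 m f ≡ ∑[ k < a + b ] X (toℕ k)
      truncated {m} f X f≡X X≡0 a≤m = begin
        sumFrom1 m f                  ≡⟨ sumList-applyUpTo (f ∘ suc) (λ i → i) m ⟩
        ∑[ i < m ] f (suc (toℕ i))    ≡⟨ sum-cong-≗ {m} (f≡X ∘ toℕ) ⟩
        ∑[ i < m ] X (toℕ i)          ≡⟨ ∑-truncate X a≤m X≡0 ⟩
        ∑[ i < a ] X (toℕ i)          ≡⟨ ∑-truncate X (m≤m+n a b) X≡0 ⟨
        ∑[ k < a + b ] X (toℕ k)      ∎
      regroup : ∀ A B P N s₁ s₂ s₃ → A * s₁ + B * s₂ + P * s₃ + N ≡ N + (P * s₃ + (A * s₁ + B * s₂))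
      regroup = solve-∀

mainTheorem11 : (a b : ℕ) → 1 ≤ a → a ≤ b → pn (K a b) ≡ pnFormula a b
mainTheorem11 a b 1≤a _ = begin
  pn (K a b)                                ≡⟨ pn≡∑pathsOfLength (K a b) ⟩
  ∑[ l < a + b ] paths (toℕ l)              ≡⟨ ∑-truncate paths (≤-trans (m≤m*n (a + b) 2) (n≤1+n _)) paths-vanish ⟨
  ∑[ l < suc ((a + b) * 2) ] paths (toℕ l)  ≡⟨ ∑-by-parity (a + b) paths ⟩
  paths 0 + ∑[ k < a + b ] (paths (suc (toℕ k * 2)) + paths (suc (suc (toℕ k * 2))))
    ≡⟨ cong₂ _+_ paths-zero (sum-cong-≗ {a + b} (λ k → cong₂ _+_ (paths-odd (toℕ k)) (paths-even (toℕ k)))) ⟩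
  a + b + ∑[ k < a + b ] (a * b * X₃ (toℕ k) + ((a C 2) * X₁ (toℕ k) + (b C 2) * X₂ (toℕ k)))
    ≡⟨ pnFormula≡∑ 1≤a ⟨
  pnFormula a b ∎
  where
  open PathsOfK a b
  open ≡-Reasoning
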